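{- Let $\Gamma$ be a simple graph of size $m>6$ and let ${\cal L}(\Gamma)$ be its line graph. Then $\gamma_a({\cal L}(\Gamma))\ge\left\lceil\sqrt{m+4}-1\right\rceil$.
   Context: For a graph $G=(V,E)$, a set $S\subseteq V$ and a vertex $v$, let $N_S(v)$ be the set of neighbours of $v$ in $S$ and $N_{V\setminus S}(v)$ the set of neighbours of $v$ in $V\setminus S$. A nonempty set $S\subseteq V$ is a defensive alliance if $|N_S(v)|+1\ge |N_{V\setminus S}(v)|$ for every $v\in S$. A defensive alliance $S$ is global if every vertex of $V\setminus S$ is adjacent to at least one vertex of $S$ (i.e. $S$ is dominating). The global defensive alliance number $\gamma_a(G)$ is the minimum cardinality of a global defensive alliance in $G$. The size of $\Gamma$ is its number of edges; the line graph ${\cal L}(\Gamma)$ has the edges of $\Gamma$ as vertices, two being adjacent when they share an endpoint. -}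

module Defs where

open import Data.Nat using (ℕ; _+_; _≤_)
open import Data.Bool using (Bool; true; false; if_then_else_; _∧_; _∨_; not)
open import Data.Fin using (Fin; toℕ; _≟_)
open import Data.Fin.Subset using (Subset; _∈_; _∉_; _∩_; ∁; ∣_∣; Nonempty)
open import Data.List using (List; []; _∷_; concatMap; length; lookup; allFin)
open import Data.Vec using (tabulate)
open import Data.Product using (_×_; _,_; ∃)
open import Relation.Nullary.Decidable using (⌊_⌋)
open import Relation.Binary.PropositionalEquality using (_≡_)
import Data.Nat as ℕ

record Graph : Set where
  field
    n   : ℕ
    adj : Fin n → Fin n → Bool
open Graph public

record IsSimple (G : Graph) : Set where
  field
    sym   : ∀ u v → adj G u v ≡ adj G v u
    irrefl : ∀ v → adj G v v ≡ false

N : (G : Graph) → Fin (n G) → Subset (n G)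
N G v = tabulate (adj G v)

IsDefensiveAlliance : (G : Graph) → Subset (n G) → Set
IsDefensiveAlliance G S =
  Nonempty S × (∀ v → v ∈ S → ∣ N G v ∩ ∁ S ∣ ≤ ∣ N G v ∩ S ∣ + 1)

IsDominating : (G : Graph) → Subset (n G) → Set
IsDominating G S = ∀ v → v ∉ S → ∃ λ u → u ∈ S × adj G v u ≡ true

IsGlobalDefensiveAlliance : (G : Graph) → Subset (n G) → Set
IsGlobalDefensiveAlliance G S = IsDefensiveAlliance G S × IsDominating G S

edges : (G : Graph) → List (Fin (n G) × Fin (n G))
edges G = concatMap (λ i → concatMap (λ j →
            if (toℕ i ℕ.<ᵇ toℕ j) ∧ adj G i j then (i , j) ∷ [] else [])
          (allFin (n G))) (allFin (n G))

size : Graph → ℕ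
size G = length (edges G)

shareEnd : ∀ {k} → Fin k × Fin k → Fin k × Fin k → Bool
shareEnd (a , b) (c , d) =
  ⌊ a ≟ c ⌋ ∨ ⌊ a ≟ d ⌋ ∨ ⌊ b ≟ c ⌋ ∨ ⌊ b ≟ d ⌋

lineGraph : Graph → Graph
lineGraph G = record
  { n   = size G
  ; adj = λ k l → not ⌊ k ≟ l ⌋ ∧ shareEnd (lookup (edges G) k) (lookup (edges G) l)
  }

{-# OPTIONS --safe #-}
-- A vertex u of a defensive alliance S has at most |S| neighbours outside S: at most
-- |S| − 1 inside (u itself is not one), plus one. Since S dominates, these |S| sets of
-- outside neighbours cover V ∖ S, so the line graph has at most |S| + |S|² vertices.
-- Then m > 6 forces |S| ≥ 3, whence m + 4 ≤ |S| + |S|² + |S| + 1 = (|S| + 1)².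
module Submission where

open import Defs
open import Data.Nat using (ℕ; _+_; _*_; _≤_; _<_)
open import Data.Fin.Subset using (Subset; ∣_∣)

open import Algebra.Bundles using (CommutativeMonoid)
open import Data.Bool using (true; _∧_; _∨_; not)
open import Data.Bool.Properties using (∨-commutativeMonoid)
open import Data.Fin using (Fin; zero; suc)
open import Data.Fin.Subset using (Empty; inside; outside; _∈_; _∉_; _⊆_; _∩_; _∪_; ∁)
open import Data.Fin.Subset.Properties
  using (_∈?_; ∣⊥∣≡0; Empty-unique; ∣p∣≤n; ∣∁p∣≡n∸∣p∣; p⊆q⇒∣p∣≤∣q∣; p⊂q⇒∣p∣<∣q∣; p∩q⊆q;
         x∈p∩q⁺; x∈p∩q⁻; x∈p∪q⁺; x∈∁p⇒x∉p; x∉p⇒x∈∁p)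
open import Data.Nat using (_∸_; s≤s)
open import Data.Nat.Properties
open import Data.Nat.Tactic.RingSolver using (solve-∀)
open import Data.Product using (∃; _×_; _,_; proj₁)
open import Data.Sum using (inj₁; inj₂)
open import Data.Vec using (_∷_; []; here; there)
open import Data.Vec.Properties using (lookup∘tabulate; []=⇒lookup; lookup⇒[]=)
open import Function using (_∘_)
open import Relation.Binary.PropositionalEquality
open import Relation.Nullary using (yes; no; contradiction)
open import Relation.Nullary.Decidable using (⌊_⌋; isYes≗does; dec-true)
import Data.Fin as Fin
import Data.List as List
open import Algebra.Properties.CommutativeSemigroup
  (CommutativeMonoid.commutativeSemigroup ∨-commutativeMonoid) using (x∙yz≈y∙xz)

∣p∪q∣≤∣p∣+∣q∣ : ∀ {n} (p q : Subset n) → ∣ p ∪ q ∣ ≤ ∣ p ∣ + ∣ q ∣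
∣p∪q∣≤∣p∣+∣q∣ []            []            = ≤-refl
∣p∪q∣≤∣p∣+∣q∣ (outside ∷ p) (outside ∷ q) = ∣p∪q∣≤∣p∣+∣q∣ p q
∣p∪q∣≤∣p∣+∣q∣ (outside ∷ p) (inside  ∷ q) =
  ≤-trans (s≤s (∣p∪q∣≤∣p∣+∣q∣ p q)) (≤-reflexive (sym (+-suc ∣ p ∣ ∣ q ∣)))
∣p∪q∣≤∣p∣+∣q∣ (inside  ∷ p) (outside ∷ q) = s≤s (∣p∪q∣≤∣p∣+∣q∣ p q)
∣p∪q∣≤∣p∣+∣q∣ (inside  ∷ p) (inside  ∷ q) =
  s≤s (≤-trans (∣p∪q∣≤∣p∣+∣q∣ p q) (+-monoʳ-≤ ∣ p ∣ (n≤1+n ∣ q ∣)))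

covered⇒∣T∣≤∣S∣*k : ∀ {n m k} (S : Subset n) (Q : Fin n → Subset m) {T : Subset m} →
  (∀ {u} → u ∈ S → ∣ Q u ∣ ≤ k) → (∀ {v} → v ∈ T → ∃ λ u → u ∈ S × v ∈ Q u) →
  ∣ T ∣ ≤ ∣ S ∣ * k
covered⇒∣T∣≤∣S∣*k {m = m} [] Q {T} _ cover =
  ≤-reflexive (trans (cong ∣_∣ (Empty-unique uncovered)) (∣⊥∣≡0 m))
  where
  uncovered : Empty T
  uncovered (_ , v∈T) with cover v∈T
  ... | _ , () , _
covered⇒∣T∣≤∣S∣*k (outside ∷ S) Q {T} bound cover =
  covered⇒∣T∣≤∣S∣*k S (Q ∘ suc) (bound ∘ there) cover′
  where
  cover′ : ∀ {v} → v ∈ T → ∃ λ u → u ∈ S × v ∈ Q (suc u)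
  cover′ v∈T with cover v∈T
  ... | suc u , there u∈S , v∈Q = u , u∈S , v∈Q
covered⇒∣T∣≤∣S∣*k {k = k} (inside ∷ S) Q {T} bound cover = begin
  ∣ T ∣                          ≤⟨ p⊆q⇒∣p∣≤∣q∣ split ⟩
  ∣ Q zero ∪ T ∩ ∁ (Q zero) ∣      ≤⟨ ∣p∪q∣≤∣p∣+∣q∣ (Q zero) (T ∩ ∁ (Q zero)) ⟩
  ∣ Q zero ∣ + ∣ T ∩ ∁ (Q zero) ∣  ≤⟨ +-mono-≤ (bound here) uncovered-by-zero ⟩
  k + ∣ S ∣ * k                    ∎
  where
  open ≤-Reasoning
  split : T ⊆ Q zero ∪ T ∩ ∁ (Q zero)
  split {v} v∈T with v ∈? Q zero
  ... | yes v∈Q = x∈p∪q⁺ (inj₁ v∈Q)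
  ... | no  v∉Q = x∈p∪q⁺ (inj₂ (x∈p∩q⁺ (v∈T , x∉p⇒x∈∁p v∉Q)))
  cover′ : ∀ {v} → v ∈ T ∩ ∁ (Q zero) → ∃ λ u → u ∈ S × v ∈ Q (suc u)
  cover′ v∈T∖Q with x∈p∩q⁻ T _ v∈T∖Q
  ... | v∈T , v∈∁Q with cover v∈T
  ...   | zero  , here       , v∈Q = contradiction v∈Q (x∈∁p⇒x∉p v∈∁Q)
  ...   | suc u , there u∈S , v∈Q = u , u∈S , v∈Q
  uncovered-by-zero : ∣ T ∩ ∁ (Q zero) ∣ ≤ ∣ S ∣ * k
  uncovered-by-zero = covered⇒∣T∣≤∣S∣*k S (Q ∘ suc) (bound ∘ there) cover′

module _ (G : Graph) {u v : Fin (n G)} where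

  ∈N⁺ : adj G u v ≡ true → v ∈ N G u
  ∈N⁺ uv = lookup⇒[]= v _ (trans (lookup∘tabulate (adj G u) v) uv)

  ∈N⁻ : v ∈ N G u → adj G u v ≡ true
  ∈N⁻ v∈N = trans (sym (lookup∘tabulate (adj G u) v)) ([]=⇒lookup v∈N)

module _ {G : Graph} (simple : IsSimple G) {S : Subset (n G)} where
  open IsSimple simple renaming (sym to adj-sym)

  ∣N∩S∣<∣S∣ : ∀ {u} → u ∈ S → ∣ N G u ∩ S ∣ < ∣ S ∣
  ∣N∩S∣<∣S∣ {u} u∈S = p⊂q⇒∣p∣<∣q∣ (p∩q⊆q (N G u) S , u , u∈S , u∉N∩S)
    where
    u∉N∩S : u ∉ N G u ∩ S
    u∉N∩S u∈N∩S =
      contradiction (trans (sym (∈N⁻ G (proj₁ (x∈p∩q⁻ _ S u∈N∩S)))) (irrefl u)) λ ()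

  ∣N∩∁S∣≤∣S∣ : IsDefensiveAlliance G S → ∀ {u} → u ∈ S → ∣ N G u ∩ ∁ S ∣ ≤ ∣ S ∣
  ∣N∩∁S∣≤∣S∣ (_ , defended) {u} u∈S = begin
    ∣ N G u ∩ ∁ S ∣     ≤⟨ defended u u∈S ⟩
    ∣ N G u ∩ S ∣ + 1   ≡⟨ +-comm _ 1 ⟩
    1 + ∣ N G u ∩ S ∣   ≤⟨ ∣N∩S∣<∣S∣ u∈S ⟩
    ∣ S ∣               ∎
    where open ≤-Reasoning

  ∣∁S∣≤∣S∣*∣S∣ : IsGlobalDefensiveAlliance G S → ∣ ∁ S ∣ ≤ ∣ S ∣ * ∣ S ∣
  ∣∁S∣≤∣S∣*∣S∣ (alliance , dominating) =
    covered⇒∣T∣≤∣S∣*k S (λ u → N G u ∩ ∁ S) (∣N∩∁S∣≤∣S∣ alliance) dominated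
    where
    dominated : ∀ {v} → v ∈ ∁ S → ∃ λ u → u ∈ S × v ∈ N G u ∩ ∁ S
    dominated {v} v∈∁S with dominating v (x∈∁p⇒x∉p v∈∁S)
    ... | u , u∈S , vu = u , u∈S , x∈p∩q⁺ (∈N⁺ G (trans (adj-sym u v) vu) , v∈∁S)

  n≤∣S∣+∣S∣*∣S∣ : IsGlobalDefensiveAlliance G S → n G ≤ ∣ S ∣ + ∣ S ∣ * ∣ S ∣
  n≤∣S∣+∣S∣*∣S∣ gda = begin
    n G                      ≡⟨ m+[n∸m]≡n (∣p∣≤n S) ⟨
    ∣ S ∣ + (n G ∸ ∣ S ∣)    ≡⟨ cong (∣ S ∣ +_) (∣∁p∣≡n∸∣p∣ S) ⟨
    ∣ S ∣ + ∣ ∁ S ∣          ≤⟨ +-monoʳ-≤ ∣ S ∣ (∣∁S∣≤∣S∣*∣S∣ gda) ⟩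
    ∣ S ∣ + ∣ S ∣ * ∣ S ∣    ∎
    where open ≤-Reasoning

⌊≟⌋-sym : ∀ {k} (a b : Fin k) → ⌊ a Fin.≟ b ⌋ ≡ ⌊ b Fin.≟ a ⌋
⌊≟⌋-sym a b with a Fin.≟ b | b Fin.≟ a
... | yes _   | yes _   = refl
... | no  _   | no  _   = refl
... | yes a≡b | no  b≢a = contradiction (sym a≡b) b≢a
... | no  a≢b | yes b≡a = contradiction (sym b≡a) a≢b

⌊≟⌋-refl : ∀ {k} (a : Fin k) → ⌊ a Fin.≟ a ⌋ ≡ true
⌊≟⌋-refl a = trans (isYes≗does (a Fin.≟ a)) (dec-true (a Fin.≟ a) refl)

shareEnd-sym : ∀ {k} (e f : Fin k × Fin k) → shareEnd e f ≡ shareEnd f e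
shareEnd-sym (a , b) (c , d)
  rewrite ⌊≟⌋-sym a c | ⌊≟⌋-sym a d | ⌊≟⌋-sym b c | ⌊≟⌋-sym b d =
  cong (⌊ c Fin.≟ a ⌋ ∨_) (x∙yz≈y∙xz ⌊ d Fin.≟ a ⌋ ⌊ c Fin.≟ b ⌋ ⌊ d Fin.≟ b ⌋)

lineGraph-isSimple : ∀ Γ → IsSimple (lineGraph Γ)
lineGraph-isSimple Γ = record
  { sym    = λ k l → cong₂ _∧_ (cong not (⌊≟⌋-sym k l)) (shareEnd-sym (edge k) (edge l))
  ; irrefl = λ k → cong (λ b → not b ∧ shareEnd (edge k) (edge k)) (⌊≟⌋-refl k)
  }
  where
  edge : Fin (size Γ) → Fin (n Γ) × Fin (n Γ)
  edge = List.lookup (edges Γ)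

6<s+s*s⇒3≤s : ∀ {s} → 6 < s + s * s → 3 ≤ s
6<s+s*s⇒3≤s 6<s+s*s = ≮⇒≥ λ s<3 → <⇒≱ 6<s+s*s (s≤2⇒s+s*s≤6 (≤-pred s<3))
  where
  s≤2⇒s+s*s≤6 : ∀ {s} → s ≤ 2 → s + s * s ≤ 6
  s≤2⇒s+s*s≤6 s≤2 = +-mono-≤ s≤2 (*-mono-≤ s≤2 s≤2)

s+s*s+4≤[s+1]² : ∀ {s} → 3 ≤ s → s + s * s + 4 ≤ (s + 1) * (s + 1)
s+s*s+4≤[s+1]² {s} 3≤s = begin
  s + s * s + 4         ≤⟨ +-monoʳ-≤ (s + s * s) (s≤s 3≤s) ⟩
  s + s * s + (1 + s)   ≡⟨ square-expansion s ⟩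
  (s + 1) * (s + 1)     ∎
  where
  open ≤-Reasoning
  square-expansion : ∀ s → s + s * s + (1 + s) ≡ (s + 1) * (s + 1)
  square-expansion = solve-∀

-- The line graph of any graph is simple.
mainTheorem6 : (Γ : Graph) → IsSimple Γ → 6 < size Γ →
    (S : Subset (n (lineGraph Γ))) → IsGlobalDefensiveAlliance (lineGraph Γ) S →
    size Γ + 4 ≤ (∣ S ∣ + 1) * (∣ S ∣ + 1)
mainTheorem6 Γ _ 6<m S gda = begin
  size Γ + 4                 ≤⟨ +-monoˡ-≤ 4 m≤s+s*s ⟩
  ∣ S ∣ + ∣ S ∣ * ∣ S ∣ + 4   ≤⟨ s+s*s+4≤[s+1]² {∣ S ∣} (6<s+s*s⇒3≤s (<-≤-trans 6<m m≤s+s*s)) ⟩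
  (∣ S ∣ + 1) * (∣ S ∣ + 1)   ∎
  where
  open ≤-Reasoning
  m≤s+s*s : size Γ ≤ ∣ S ∣ + ∣ S ∣ * ∣ S ∣
  m≤s+s*s = n≤∣S∣+∣S∣*∣S∣ (lineGraph-isSimple Γ) gda
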